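{- If $A$ is an L-primitive set, then $\mathrm{L}_a$ and $\mathrm{L}_{a'}$ are disjoint for all distinct $a,a'\in A$.
   Context: For an integer $a>1$ let $P(a)$ be its largest prime factor and $\mathrm{L}_a=\{ba : b\in\mathbb{N},\ \text{every prime } p\mid b \text{ satisfies } p\ge P(a)\}$. A set $A\subset\mathbb{Z}_{>1}$ is L-primitive if $a'\notin\mathrm{L}_a$ for all distinct $a,a'\in A$. -}

module Defs where

open import Data.Nat using (ℕ; _*_; _≤_; _<_)
open import Data.Nat.Divisibility using (_∣_)
open import Data.Nat.Primality using (Prime)
open import Data.Product using (_×_; ∃-syntax)
open import Relation.Binary.PropositionalEquality using (_≡_; _≢_)
open import Relation.Nullary using (¬_)

IsLargestPrimeFactor : ℕ → ℕ → Set
IsLargestPrimeFactor a p = Prime p × p ∣ a × (∀ q → Prime q → q ∣ a → q ≤ p)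

InL : ℕ → ℕ → Set
InL a n = ∃[ b ] ∃[ P ] (IsLargestPrimeFactor a P × 1 ≤ b × n ≡ b * a
            × (∀ q → Prime q → q ∣ b → P ≤ q))

LPrimitive : (ℕ → Set) → Set
LPrimitive A = (∀ a → A a → 1 < a)
             × (∀ a a' → A a → A a' → a ≢ a' → ¬ InL a a')

-- Write a = x·g and a' = y·g with g = gcd(a, a') and x, y coprime. If b·a = n = b'·a', where all
-- prime factors of b are ≥ P(a) and those of b' are ≥ P(a'), then y ∣ b and x ∣ b'. If x = 1 then
-- a' = y·a ∈ L_a, and symmetrically if y = 1. Otherwise primes q ∣ x and r ∣ y satisfy
-- q ≤ P(a) ≤ r ≤ P(a') ≤ q, so q = r divides both x and y, contradicting coprimality.
module Submission where

open import Defs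
open import Data.Nat using (ℕ; zero; suc; _*_; _≤_; _<_; NonZero; ≢-nonZero; ≢-nonZero⁻¹; >-nonZero; s≤s; z≤n)
open import Data.Nat.Properties using (_≟_; *-identityˡ; *-comm; *-assoc; *-cancelʳ-≡; ≤-trans; ≤-antisym; ≤∧≢⇒<; >⇒≢; <⇒≤)
open import Data.Nat.Divisibility using (_∣_; ∣-trans; m∣m*n; n∣m*n; 0∣⇒≡0)
open import Data.Nat.DivMod using (m/n*n≡m)
open import Data.Nat.GCD using (gcd; gcd[m,n]∣m; gcd[m,n]∣n; gcd[m,n]≢0)
open import Data.Nat.Coprimality using (Coprime; coprime-/gcd; coprime-divisor) renaming (sym to coprime-sym)
open import Data.Nat.Primality using (Prime; ¬prime[1])
open import Data.Nat.Primality.Factorisation using (factorise)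
open import Data.Nat.ListAction using (product)
open import Data.List.Base using ([]; _∷_)
open import Data.List.Relation.Unary.All using (_∷_)
open import Data.Product using (_×_; _,_; ∃-syntax)
open import Data.Sum using (_⊎_; inj₁; inj₂)
open import Data.Empty using (⊥; ⊥-elim)
open import Relation.Binary.PropositionalEquality using (_≡_; _≢_; refl; sym; trans; cong; subst; ≢-sym; module ≡-Reasoning)
open import Relation.Nullary using (¬_; Dec; yes; no; contradiction)

PrimeFactors≥ : ℕ → ℕ → Set
PrimeFactors≥ P b = ∀ q → Prime q → q ∣ b → P ≤ q

primeFactors≥-∣ : ∀ {P b c} → c ∣ b → PrimeFactors≥ P b → PrimeFactors≥ P c
primeFactors≥-∣ c∣b b-rough q q-prime q∣c = b-rough q q-prime (∣-trans q∣c c∣b)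

∣-positive : ∀ {m n} → m ∣ n → 1 ≤ n → 1 ≤ m
∣-positive {zero}  0∣n 1≤n = contradiction (0∣⇒≡0 0∣n) (>⇒≢ 1≤n)
∣-positive {suc m} _   _   = s≤s z≤n

prime-divisor : ∀ {n} → 1 < n → ∃[ p ] Prime p × p ∣ n
prime-divisor {suc n} 1<n with factorise (suc n)
... | record { factors = [] ; isFactorisation = n≡1 } = contradiction n≡1 (>⇒≢ 1<n)
... | record { factors = p ∷ ps ; isFactorisation = n≡p*ps ; factorsPrime = p-prime ∷ _ } =
  p , p-prime , subst (p ∣_) (sym n≡p*ps) (m∣m*n (product ps))

coprime⇒¬common-prime : ∀ {x y p} → Coprime x y → Prime p → p ∣ x → p ∣ y → ⊥
coprime⇒¬common-prime x⊥y p-prime p∣x p∣y = ¬prime[1] (subst Prime (x⊥y (p∣x , p∣y)) p-prime)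

coprime-cofactor-∣ : ∀ {x y g b b'} .{{_ : NonZero g}} →
                     Coprime x y → b * (x * g) ≡ b' * (y * g) → y ∣ b
coprime-cofactor-∣ {x} {y} {g} {b} {b'} x⊥y b*xg≡b'*yg =
  coprime-divisor (coprime-sym x⊥y) (subst (y ∣_) b'*y≡x*b (n∣m*n b'))
  where
  open ≡-Reasoning
  b'*y≡x*b : b' * y ≡ x * b
  b'*y≡x*b = *-cancelʳ-≡ (b' * y) (x * b) g (begin
    b' * y * g    ≡⟨ *-assoc b' y g ⟩
    b' * (y * g)  ≡⟨ sym b*xg≡b'*yg ⟩
    b * (x * g)   ≡⟨ sym (*-assoc b x g) ⟩
    b * x * g     ≡⟨ cong (_* g) (*-comm b x) ⟩
    x * b * g     ∎)

InL-multiple : ∀ {a P c m} → IsLargestPrimeFactor a P → 1 ≤ c → PrimeFactors≥ P c →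
               m ≡ c * a → InL a m
InL-multiple lpf 1≤c c-rough m≡c*a = _ , _ , lpf , 1≤c , m≡c*a , c-rough

InL-overlap-cofactors : ∀ {x y g a a' n} .{{_ : NonZero g}} → Coprime x y →
                        a ≡ x * g → a' ≡ y * g → InL a n → InL a' n → InL a a' ⊎ InL a' a
InL-overlap-cofactors {x} {y} {g} x⊥y refl refl
  (b  , P  , lpf@(_ , _ , P-max)   , 1≤b  , n≡b*a  , b-rough)
  (b' , P' , lpf'@(_ , _ , P'-max) , 1≤b' , n≡b'*a' , b'-rough)
  = cases (x ≟ 1) (y ≟ 1)
  where
  y∣b : y ∣ b
  y∣b = coprime-cofactor-∣ {b' = b'} x⊥y (trans (sym n≡b*a) n≡b'*a')

  x∣b' : x ∣ b'
  x∣b' = coprime-cofactor-∣ {b' = b} (coprime-sym x⊥y) (trans (sym n≡b'*a') n≡b*a)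

  unit-cofactor : ∀ {z} → z ≡ 1 → g ≡ z * g
  unit-cofactor refl = sym (*-identityˡ g)

  cases : Dec (x ≡ 1) → Dec (y ≡ 1) → InL (x * g) (y * g) ⊎ InL (y * g) (x * g)
  cases (yes x≡1) _ = inj₁ (InL-multiple lpf (∣-positive y∣b 1≤b) (primeFactors≥-∣ y∣b b-rough)
                                         (cong (y *_) (unit-cofactor x≡1)))
  cases (no _) (yes y≡1) = inj₂ (InL-multiple lpf' (∣-positive x∣b' 1≤b') (primeFactors≥-∣ x∣b' b'-rough)
                                              (cong (x *_) (unit-cofactor y≡1)))
  cases (no x≢1) (no y≢1)
    with prime-divisor (≤∧≢⇒< (∣-positive x∣b' 1≤b') (≢-sym x≢1))
       | prime-divisor (≤∧≢⇒< (∣-positive y∣b 1≤b) (≢-sym y≢1))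
  ... | q , q-prime , q∣x | r , r-prime , r∣y =
    ⊥-elim (coprime⇒¬common-prime x⊥y q-prime q∣x (subst (_∣ y) (sym q≡r) r∣y))
    where
    q≡r : q ≡ r
    q≡r = ≤-antisym
      (≤-trans (P-max q q-prime (∣-trans q∣x (m∣m*n g))) (b-rough r r-prime (∣-trans r∣y y∣b)))
      (≤-trans (P'-max r r-prime (∣-trans r∣y (m∣m*n g))) (b'-rough q q-prime (∣-trans q∣x x∣b')))

InL-overlap : ∀ {a a' n} .{{_ : NonZero a}} → InL a n → InL a' n → InL a a' ⊎ InL a' a
InL-overlap {a} {a'} =
  InL-overlap-cofactors (coprime-/gcd a a')
    (sym (m/n*n≡m (gcd[m,n]∣m a a'))) (sym (m/n*n≡m (gcd[m,n]∣n a a')))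
  where
  instance
    gcd-nonZero : NonZero (gcd a a')
    gcd-nonZero = ≢-nonZero (gcd[m,n]≢0 a a' (inj₁ (≢-nonZero⁻¹ a)))

corollary2p2 : (A : ℕ → Set) → LPrimitive A →
    ∀ a a' → A a → A a' → a ≢ a' → ∀ n → ¬ (InL a n × InL a' n)
corollary2p2 A (A>1 , A-primitive) a a' Aa Aa' a≢a' n (a∈L , a'∈L)
  with InL-overlap {{>-nonZero (<⇒≤ (A>1 a Aa))}} a∈L a'∈L
... | inj₁ a'∈La = A-primitive a a' Aa Aa' a≢a' a'∈La
... | inj₂ a∈La' = A-primitive a' a Aa' Aa (≢-sym a≢a') a∈La'
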